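{- Let $k$, $n$, $r$ be integers with $k\ge 2$, $r\ge 2$ and $n\ge k+2r$. Then: (1) $\gamma_k(n,r)=k+r$ if and only if $n\ge r(k+r)$; moreover, when $n\ge r(k+r)$, every $k$-dominating set of $K(n,r)$ of cardinality $\gamma_k(n,r)$ is a clique (i.e. consists of pairwise disjoint $r$-sets); (2) $\gamma_k(n,r)\ge k+r+1$ if and only if $n<r(k+r)$.
   Context: For integers $n\ge 2r\ge 2$, the Kneser graph $K(n,r)$ has as vertices the $r$-element subsets of $[n]=\{1,\dots,n\}$, two vertices being adjacent iff they are disjoint. For a graph $G$ and positive integer $k$, a set $D\subseteq V(G)$ is a $k$-dominating set if every vertex $u\in V(G)\setminus D$ has at least $k$ neighbors in $D$; $\gamma_k(G)$ is the minimum cardinality of a $k$-dominating set. Write $\gamma_k(n,r)=\gamma_k(K(n,r))$. -}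

module Defs where

open import Data.Nat using (ℕ; _≤_; _+_)
open import Data.Bool using () renaming (_≟_ to _≟ᵇ_)
open import Data.Fin.Subset using (Subset; ⊥; _∩_; ∣_∣)
open import Data.Vec.Properties using (≡-dec)
open import Data.List using (List; length; filter)
open import Data.List.Relation.Unary.All using (All)
open import Data.List.Relation.Unary.Unique.Propositional using (Unique)
open import Data.List.Relation.Unary.AllPairs using (AllPairs)
open import Data.List.Membership.Propositional using (_∉_)
open import Data.Product using (Σ; _×_)
open import Relation.Binary.PropositionalEquality using (_≡_)
open import Relation.Nullary using (Dec)

-- Vertices of the Kneser graph K(n,r): subsets u of [n] = Fin n with ∣ u ∣ ≡ r.
IsVertex : (n r : ℕ) → Subset n → Set
IsVertex n r u = ∣ u ∣ ≡ r

Adj : {n : ℕ} → Subset n → Subset n → Set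
Adj u v = u ∩ v ≡ ⊥

adj? : {n : ℕ} → (u v : Subset n) → Dec (Adj u v)
adj? u v = ≡-dec _≟ᵇ_ (u ∩ v) ⊥

-- A set of vertices: a duplicate-free list of r-subsets of [n]; cardinality = length.
IsVertexSet : (n r : ℕ) → List (Subset n) → Set
IsVertexSet n r D = All (IsVertex n r) D × Unique D

nbrCount : {n : ℕ} → Subset n → List (Subset n) → ℕ
nbrCount u D = length (filter (adj? u) D)

IsKDom : (k n r : ℕ) → List (Subset n) → Set
IsKDom k n r D = IsVertexSet n r D ×
  ((u : Subset n) → IsVertex n r u → u ∉ D → k ≤ nbrCount u D)

GammaIs : (k n r m : ℕ) → Set
GammaIs k n r m =
  Σ (List (Subset n)) (λ D → IsKDom k n r D × length D ≡ m) ×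
  ((D : List (Subset n)) → IsKDom k n r D → m ≤ length D)

GammaAtLeast : (k n r m : ℕ) → Set
GammaAtLeast k n r m = (D : List (Subset n)) → IsKDom k n r D → m ≤ length D

IsClique : {n : ℕ} → List (Subset n) → Set
IsClique D = AllPairs Adj D

-- Let D be a k-dominating set of K(n,r) with |D| ≤ k + r. Then there is no set S of fewer than
-- r points such that |S| plus the number of members of D disjoint from S is below k + r.
-- Such an S could be grown, one point at a time and keeping that sum below k + r, to an
-- (r−1)-set S with at most k members of D disjoint from it (add a point of a disjoint member,
-- or an arbitrary point once at most k remain). If fewer than k, one of the n − r + 1 > |D|
-- extensions of S by a point is an r-set outside D with fewer than k neighbours in D. If exactly
-- k, at most r members meet S, and two disjoint members E₁ ≠ E₂ give |E₁ ∪ E₂| ≥ r + 1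
-- extensions of S, one of which is outside D and disjoint from fewer members than S.
-- With S = ∅ this gives γ_k(n,r) ≥ k + r; if |D| = k + r and two members share a point x,
-- S = {x} is such a set, so D is a clique, which needs r(k + r) ≤ n points. Conversely k + r
-- pairwise disjoint r-sets are k-dominating, since an r-set meets at most r of them.

module Submission where

open import Defs
open import Data.Nat using (ℕ; zero; suc; _≤_; _<_; _+_; _*_; _∸_; z≤n; s≤s; z<s; _≤?_)
open import Data.Nat.Properties
open import Data.Nat.Tactic.RingSolver using (solve-∀)
open import Data.Bool using () renaming (_≟_ to _≟ᵇ_)
import Data.Fin as Fin
open import Data.Fin using (Fin)
open import Data.Fin.Properties using () renaming (suc-injective to suc-injectiveᶠ)
open import Function using (_∘_; id)
open import Data.Vec using ([]; _∷_; _++_; here; there)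
open import Data.Vec.Properties using (≡-dec; ∷-injective)
open import Data.Fin.Subset
  using (Subset; ⊥; ⊤; _∩_; _∪_; _─_; ∣_∣; ⁅_⁆; _∈_; _∉_; _⊆_; ∁; Nonempty; inside; outside)
open import Data.Fin.Subset.Properties
  using (∉⊥; ∈⊤; x∈p∩q⁺; x∈p∩q⁻; x∈p∪q⁺; x∈p∪q⁻; p∩q⊆p; p∩q⊆q; x∈⁅x⁆; x∈⁅y⁆⇒x≡y; ∣⁅x⁆∣≡1; ∣⊥∣≡0; ∣⊤∣≡n;
         p⊆q⇒∣p∣≤∣q∣; ∣∁p∣≡n∸∣p∣; x∈∁p⇒x∉p; p⊆p∪q; q⊆p∪q; x∈p∧x∉q⇒x∈p─q; drop-∷-⊆;
         Empty-unique; nonempty?; ∪-identityʳ; ∩-zeroˡ; ∩-zeroʳ; ∩-inverseʳ)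
open import Data.List using (List; []; _∷_; length; filter; map)
open import Data.List.Properties using (length-map; filter-all; filter-notAll)
open import Data.List.Membership.Propositional using (find) renaming (_∈_ to _∈ₗ_; _∉_ to _∉ₗ_)
open import Data.List.Membership.Propositional.Properties using (∈-filter⁺; ∈-filter⁻; ∈-map⁻)
import Data.List.Membership.DecPropositional as DecMembership
open import Data.List.Relation.Unary.Any as Any using (here; there)
open import Data.List.Relation.Unary.All as All using (All; []; _∷_)
open import Data.List.Relation.Unary.All.Properties using (¬All⇒Any¬) renaming (map⁺ to All-map⁺)
open import Data.List.Relation.Unary.AllPairs using (AllPairs; []; _∷_)
import Data.List.Relation.Unary.AllPairs as AllPairs
import Data.List.Relation.Unary.AllPairs.Properties as AllPairs
open import Data.List.Relation.Unary.Unique.Propositional using (Unique)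
import Data.List.Relation.Unary.Unique.Propositional.Properties as Unique
import Data.List.Relation.Binary.Sublist.Propositional as Sublist
import Data.List.Relation.Binary.Sublist.Propositional.Properties as Sublist
open import Data.List.Relation.Binary.Equality.Propositional using (≋⇒≡)
open import Data.Product using (Σ; Σ-syntax; ∃; ∃₂; _×_; _,_; proj₁; proj₂)
open import Data.Sum using (_⊎_; inj₁; inj₂; [_,_]′)
open import Function.Bundles using (_⇔_; mk⇔)
open import Relation.Nullary using (¬_; yes; no; contradiction)
open import Relation.Unary using (Pred; Decidable)
open import Relation.Unary.Properties using (∁?)
open import Relation.Binary.Definitions using (DecidableEquality)
open import Relation.Binary.PropositionalEquality
  using (_≡_; _≢_; refl; sym; trans; cong; cong₂; subst)

module _ {a} {A : Set a} where

  module _ {p q} {P : Pred A p} {Q : Pred A q} (P? : Decidable P) (Q? : Decidable Q)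
           (P⇒Q : ∀ {x} → P x → Q x) where

    filter-⊆-filter : (xs : List A) → Sublist._⊆_ (filter P? xs) (filter Q? xs)
    filter-⊆-filter xs = Sublist.filter⁺ P? Q? {as = xs} {bs = xs} (λ { refl → P⇒Q }) Sublist.⊆-refl

    length-filter-mono : (xs : List A) → length (filter P? xs) ≤ length (filter Q? xs)
    length-filter-mono xs = Sublist.length-mono-≤ {as = filter P? xs} (filter-⊆-filter xs)

    length-filter-mono-< : ∀ {x xs} → x ∈ₗ xs → Q x → ¬ P x →
                           length (filter P? xs) < length (filter Q? xs)
    length-filter-mono-< {x} {xs} x∈xs Qx ¬Px = ≤∧≢⇒< (length-filter-mono xs) λ same-length →
      let filters-equal = ≋⇒≡ (Sublist.to-≋ same-length (filter-⊆-filter xs))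
      in ¬Px (proj₂ (∈-filter⁻ P? {xs = xs} (subst (x ∈ₗ_) (sym filters-equal) (∈-filter⁺ Q? x∈xs Qx))))

  length-filter+length-filter-∁ : ∀ {p} {P : Pred A p} (P? : Decidable P) (xs : List A) →
    length (filter P? xs) + length (filter (∁? P?) xs) ≡ length xs
  length-filter+length-filter-∁ P? [] = refl
  length-filter+length-filter-∁ P? (x ∷ xs) with P? x
  ... | yes _ = cong suc (length-filter+length-filter-∁ P? xs)
  ... | no _  = trans (+-suc _ _) (cong suc (length-filter+length-filter-∁ P? xs))

  0<length⇒∃∈ : ∀ {xs : List A} → 0 < length xs → ∃ λ x → x ∈ₗ xs
  0<length⇒∃∈ {x ∷ _} _ = x , here refl

  2≤length⇒∃≢ : ∀ {xs : List A} → Unique xs → 2 ≤ length xs →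
                ∃₂ λ x y → x ∈ₗ xs × y ∈ₗ xs × x ≢ y
  2≤length⇒∃≢ {x ∷ y ∷ _} ((x≢y ∷ _) ∷ _) _ = x , y , here refl , there (here refl) , x≢y
  2≤length⇒∃≢ {_ ∷ []} _ (s≤s ())

  Unique-map⁺-injectiveOn : ∀ {b} {B : Set b} {f : A → B} {xs : List A} →
                (∀ {x y} → x ∈ₗ xs → y ∈ₗ xs → f x ≡ f y → x ≡ y) → Unique xs → Unique (map f xs)
  Unique-map⁺-injectiveOn inj [] = []
  Unique-map⁺-injectiveOn inj (x∉xs ∷ xs!) =
    All-map⁺ (All.tabulate λ y∈xs fx≡fy → All.lookup x∉xs y∈xs (inj (here refl) (there y∈xs) fx≡fy))
    ∷ Unique-map⁺-injectiveOn (λ x∈ y∈ → inj (there x∈) (there y∈)) xs!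

  Unique⇒AllPairs : ∀ {r} {R : A → A → Set r} {xs : List A} → Unique xs →
                    (∀ {x y} → x ∈ₗ xs → y ∈ₗ xs → x ≢ y → R x y) → AllPairs R xs
  Unique⇒AllPairs [] _ = []
  Unique⇒AllPairs (x∉xs ∷ xs!) R-distinct =
    All.tabulate (λ y∈xs → R-distinct (here refl) (there y∈xs) (All.lookup x∉xs y∈xs))
    ∷ Unique⇒AllPairs xs! (λ x∈ y∈ → R-distinct (there x∈) (there y∈))

  module _ (_≟_ : DecidableEquality A) where

    open DecMembership _≟_ using (_∈?_)

    Unique⇒length≤ : ∀ {xs ys : List A} → Unique xs → (∀ {x} → x ∈ₗ xs → x ∈ₗ ys) →
                     length xs ≤ length ys
    Unique⇒length≤ {[]} _ _ = z≤n
    Unique⇒length≤ {x ∷ xs} {ys} (x∉xs ∷ xs!) xs⊆ys = begin-strict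
      length xs                           ≤⟨ Unique⇒length≤ xs! xs⊆ys-without-x ⟩
      length (filter (∁? (x ≟_)) ys)      <⟨ filter-notAll (∁? (x ≟_)) ys x∈ys ⟩
      length ys                           ∎
      where
      open ≤-Reasoning
      xs⊆ys-without-x : ∀ {y} → y ∈ₗ xs → y ∈ₗ filter (∁? (x ≟_)) ys
      xs⊆ys-without-x y∈xs = ∈-filter⁺ (∁? (x ≟_)) (xs⊆ys (there y∈xs)) (All.lookup x∉xs y∈xs)
      x∈ys = Any.map (λ x≡y x≢y → x≢y x≡y) (xs⊆ys (here refl))

    pigeonhole-∉ : ∀ {xs ys : List A} → Unique xs → length ys < length xs →
                   ∃ λ x → x ∈ₗ xs × x ∉ₗ ys
    pigeonhole-∉ {xs} {ys} xs! ys<xs with All.all? (_∈? ys) xs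
    ... | yes xs⊆ys = contradiction (Unique⇒length≤ xs! (All.lookup xs⊆ys)) (<⇒≱ ys<xs)
    ... | no xs⊈ys  = find (¬All⇒Any¬ (_∈? ys) xs xs⊈ys)

private
  variable
    n : ℕ
    p q : Subset n
    x y : Fin n

_≟ˢ_ : DecidableEquality (Subset n)
_≟ˢ_ = ≡-dec _≟ᵇ_

Adj⇒∉ : Adj p q → x ∈ p → x ∉ q
Adj⇒∉ p∩q≡⊥ x∈p x∈q = ∉⊥ (subst (_ ∈_) p∩q≡⊥ (x∈p∩q⁺ (x∈p , x∈q)))

∉⇒Adj : (∀ {x} → x ∈ p → x ∉ q) → Adj p q
∉⇒Adj {p = p} {q = q} disjoint =
  Empty-unique λ (x , x∈p∩q) → let x∈p , x∈q = x∈p∩q⁻ p q x∈p∩q in disjoint x∈p x∈q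

¬Adj⇒∃∈ : ¬ Adj p q → ∃ λ x → x ∈ p × x ∈ q
¬Adj⇒∃∈ {p = p} {q = q} ¬adj with nonempty? (p ∩ q)
... | yes (x , x∈p∩q) = x , x∈p∩q⁻ p q x∈p∩q
... | no empty        = contradiction (Empty-unique empty) ¬adj

Adj-antitone : ∀ {p p′ q q′ : Subset n} → p ⊆ p′ → q ⊆ q′ → Adj p′ q′ → Adj p q
Adj-antitone p⊆p′ q⊆q′ p′∩q′≡⊥ = ∉⇒Adj λ x∈p x∈q → Adj⇒∉ p′∩q′≡⊥ (p⊆p′ x∈p) (q⊆q′ x∈q)

Nonempty⇒¬Adj-self : Nonempty p → ¬ Adj p p
Nonempty⇒¬Adj-self (_ , x∈p) p∩p≡⊥ = Adj⇒∉ p∩p≡⊥ x∈p x∈p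

x∈p⇒⁅x⁆⊆p : x ∈ p → ⁅ x ⁆ ⊆ p
x∈p⇒⁅x⁆⊆p {x = x} {p = p} x∈p y∈⁅x⁆ = subst (_∈ p) (sym (x∈⁅y⁆⇒x≡y x y∈⁅x⁆)) x∈p

Nonempty⇒∣p∣≥1 : Nonempty p → 1 ≤ ∣ p ∣
Nonempty⇒∣p∣≥1 {p = p} (x , x∈p) = begin
  1          ≡⟨ sym (∣⁅x⁆∣≡1 x) ⟩
  ∣ ⁅ x ⁆ ∣  ≤⟨ p⊆q⇒∣p∣≤∣q∣ (x∈p⇒⁅x⁆⊆p x∈p) ⟩
  ∣ p ∣      ∎
  where open ≤-Reasoning

∣p∣>0⇒Nonempty : ∀ {n} {p : Subset n} → 0 < ∣ p ∣ → Nonempty p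
∣p∣>0⇒Nonempty {n} {p} 0<∣p∣ with nonempty? p
... | yes nonempty = nonempty
... | no empty     = contradiction (trans (cong ∣_∣ (Empty-unique empty)) (∣⊥∣≡0 n)) (>⇒≢ 0<∣p∣)

∣p∣<n⇒∃∉ : ∀ {p : Subset n} → ∣ p ∣ < n → ∃ λ x → x ∉ p
∣p∣<n⇒∃∉ {p = p} ∣p∣<n =
  let x , x∈∁p = ∣p∣>0⇒Nonempty (subst (0 <_) (sym (∣∁p∣≡n∸∣p∣ p)) (m<n⇒0<n∸m ∣p∣<n))
  in x , x∈∁p⇒x∉p x∈∁p

∣p∪⁅x⁆∣≡1+∣p∣ : ∀ (p : Subset n) x → x ∉ p → ∣ p ∪ ⁅ x ⁆ ∣ ≡ suc ∣ p ∣
∣p∪⁅x⁆∣≡1+∣p∣ (inside  ∷ p) Fin.zero    x∉p = contradiction here x∉p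
∣p∪⁅x⁆∣≡1+∣p∣ (outside ∷ p) Fin.zero    _   = cong (suc ∘ ∣_∣) (∪-identityʳ p)
∣p∪⁅x⁆∣≡1+∣p∣ (inside  ∷ p) (Fin.suc x) x∉p = cong suc (∣p∪⁅x⁆∣≡1+∣p∣ p x (x∉p ∘ there))
∣p∪⁅x⁆∣≡1+∣p∣ (outside ∷ p) (Fin.suc x) x∉p = ∣p∪⁅x⁆∣≡1+∣p∣ p x (x∉p ∘ there)

∪⁅⁆-injective : x ∉ p → p ∪ ⁅ x ⁆ ≡ p ∪ ⁅ y ⁆ → x ≡ y
∪⁅⁆-injective {x = x} {p = p} {y = y} x∉p same
  with x∈p∪q⁻ p ⁅ y ⁆ (subst (x ∈_) same (x∈p∪q⁺ (inj₂ (x∈⁅x⁆ x))))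
... | inj₁ x∈p   = contradiction x∈p x∉p
... | inj₂ x∈⁅y⁆ = x∈⁅y⁆⇒x≡y y x∈⁅y⁆

∣p∣≡∣p─q∣+∣q∣ : ∀ {p q : Subset n} → q ⊆ p → ∣ p ∣ ≡ ∣ p ─ q ∣ + ∣ q ∣
∣p∣≡∣p─q∣+∣q∣ {p = []}          {[]}            _   = refl
∣p∣≡∣p─q∣+∣q∣ {p = inside  ∷ p} {inside  ∷ q} q⊆p =
  trans (cong suc (∣p∣≡∣p─q∣+∣q∣ (drop-∷-⊆ q⊆p))) (sym (+-suc _ _))
∣p∣≡∣p─q∣+∣q∣ {p = inside  ∷ p} {outside ∷ q} q⊆p = cong suc (∣p∣≡∣p─q∣+∣q∣ (drop-∷-⊆ q⊆p))
∣p∣≡∣p─q∣+∣q∣ {p = outside ∷ p} {outside ∷ q} q⊆p = ∣p∣≡∣p─q∣+∣q∣ (drop-∷-⊆ q⊆p)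
∣p∣≡∣p─q∣+∣q∣ {p = outside ∷ p} {inside  ∷ q} q⊆p with q⊆p here
... | ()

p⊆q∧∣q∣≤∣p∣⇒p≡q : ∀ {p q : Subset n} → p ⊆ q → ∣ q ∣ ≤ ∣ p ∣ → p ≡ q
p⊆q∧∣q∣≤∣p∣⇒p≡q {p = []}          {[]}          _   _ = refl
p⊆q∧∣q∣≤∣p∣⇒p≡q {p = inside  ∷ p} {inside  ∷ q} p⊆q (s≤s ∣q∣≤∣p∣) =
  cong (inside ∷_) (p⊆q∧∣q∣≤∣p∣⇒p≡q (drop-∷-⊆ p⊆q) ∣q∣≤∣p∣)
p⊆q∧∣q∣≤∣p∣⇒p≡q {p = outside ∷ p} {outside ∷ q} p⊆q ∣q∣≤∣p∣ =
  cong (outside ∷_) (p⊆q∧∣q∣≤∣p∣⇒p≡q (drop-∷-⊆ p⊆q) ∣q∣≤∣p∣)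
p⊆q∧∣q∣≤∣p∣⇒p≡q {p = outside ∷ p} {inside  ∷ q} p⊆q ∣q∣<∣p∣ =
  contradiction (p⊆q⇒∣p∣≤∣q∣ (drop-∷-⊆ p⊆q)) (<⇒≱ ∣q∣<∣p∣)
p⊆q∧∣q∣≤∣p∣⇒p≡q {p = inside  ∷ p} {outside ∷ q} p⊆q _ with p⊆q here
... | ()

∣p∣<∣p∪q∣ : ∀ {p q : Subset n} → p ≢ q → ∣ p ∣ ≡ ∣ q ∣ → ∣ p ∣ < ∣ p ∪ q ∣
∣p∣<∣p∪q∣ {p = p} {q = q} p≢q ∣p∣≡∣q∣ = ≤∧≢⇒< (p⊆q⇒∣p∣≤∣q∣ (p⊆p∪q {p = p} q)) λ ∣p∣≡∣p∪q∣ →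
  p≢q (trans (p⊆q∧∣q∣≤∣p∣⇒p≡q (p⊆p∪q {p = p} q) (≤-reflexive (sym ∣p∣≡∣p∪q∣)))
             (sym (p⊆q∧∣q∣≤∣p∣⇒p≡q (q⊆p∪q p q) (≤-reflexive (trans (sym ∣p∣≡∣p∪q∣) ∣p∣≡∣q∣)))))

∣p++q∣≡∣p∣+∣q∣ : ∀ {a b} (p : Subset a) (q : Subset b) → ∣ p ++ q ∣ ≡ ∣ p ∣ + ∣ q ∣
∣p++q∣≡∣p∣+∣q∣ []            q = refl
∣p++q∣≡∣p∣+∣q∣ (inside  ∷ p) q = cong suc (∣p++q∣≡∣p∣+∣q∣ p q)
∣p++q∣≡∣p∣+∣q∣ (outside ∷ p) q = ∣p++q∣≡∣p∣+∣q∣ p q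

Adj-++ : ∀ {a b} {p p′ : Subset a} {q q′ : Subset b} → Adj p p′ → Adj q q′ → Adj (p ++ q) (p′ ++ q′)
Adj-++ {p = []}    {[]}     _    q∩q′≡⊥ = q∩q′≡⊥
Adj-++ {p = _ ∷ _} {_ ∷ _} p∩p′≡⊥ q∩q′≡⊥ =
  let head≡ , tail≡ = ∷-injective p∩p′≡⊥ in cong₂ _∷_ head≡ (Adj-++ tail≡ q∩q′≡⊥)

elements : Subset n → List (Fin n)
elements []            = []
elements (inside  ∷ p) = Fin.zero ∷ map Fin.suc (elements p)
elements (outside ∷ p) = map Fin.suc (elements p)

length-elements : ∀ (p : Subset n) → length (elements p) ≡ ∣ p ∣
length-elements []            = refl
length-elements (inside  ∷ p) = cong suc (trans (length-map Fin.suc (elements p)) (length-elements p))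
length-elements (outside ∷ p) = trans (length-map Fin.suc (elements p)) (length-elements p)

∈-elements⁻ : ∀ (p : Subset n) → x ∈ₗ elements p → x ∈ p
∈-elements⁻ (inside  ∷ p) (here refl) = here
∈-elements⁻ (inside  ∷ p) (there x∈)  with ∈-map⁻ Fin.suc x∈
... | _ , y∈ , refl = there (∈-elements⁻ p y∈)
∈-elements⁻ (outside ∷ p) x∈          with ∈-map⁻ Fin.suc x∈
... | _ , y∈ , refl = there (∈-elements⁻ p y∈)

elements-Unique : ∀ (p : Subset n) → Unique (elements p)
elements-Unique []            = []
elements-Unique (inside  ∷ p) =
  All-map⁺ (All.tabulate λ _ ()) ∷ Unique.map⁺ suc-injectiveᶠ (elements-Unique p)
elements-Unique (outside ∷ p) = Unique.map⁺ suc-injectiveᶠ (elements-Unique p)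

∃-extension-∉ : ∀ (S T : Subset n) → Adj S T → (M : List (Subset n)) → length M < ∣ T ∣ →
                ∃ λ z → z ∈ T × S ∪ ⁅ z ⁆ ∉ₗ M
∃-extension-∉ S T S∩T≡⊥ M M<∣T∣
  with pigeonhole-∉ _≟ˢ_ (Unique-map⁺-injectiveOn injective (elements-Unique T)) M<candidates
  where
  injective : ∀ {x y} → x ∈ₗ elements T → y ∈ₗ elements T → S ∪ ⁅ x ⁆ ≡ S ∪ ⁅ y ⁆ → x ≡ y
  injective x∈T _ = ∪⁅⁆-injective λ x∈S → Adj⇒∉ S∩T≡⊥ x∈S (∈-elements⁻ T x∈T)
  M<candidates : length M < length (map (λ z → S ∪ ⁅ z ⁆) (elements T))
  M<candidates = subst (length M <_) (sym (trans (length-map _ (elements T)) (length-elements T))) M<∣T∣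
... | _ , c∈ , c∉M with ∈-map⁻ _ c∈
... | z , z∈T , refl = z , ∈-elements⁻ T z∈T , c∉M

meeting : Subset n → List (Subset n) → List (Subset n)
meeting u D = filter (∁? (adj? u)) D

nbrCount+meeting≡length : ∀ (u : Subset n) D → nbrCount u D + length (meeting u D) ≡ length D
nbrCount+meeting≡length u = length-filter+length-filter-∁ (adj? u)

⊆-∈-meeting : ∀ {D} → p ⊆ q → Nonempty p → q ∈ₗ D → q ∈ₗ meeting p D
⊆-∈-meeting p⊆q (x , x∈p) q∈D = ∈-filter⁺ (∁? (adj? _)) q∈D λ p∩q≡⊥ → Adj⇒∉ p∩q≡⊥ x∈p (p⊆q x∈p)

nbrCount-antitone : p ⊆ q → ∀ D → nbrCount q D ≤ nbrCount p D
nbrCount-antitone p⊆q = length-filter-mono (adj? _) (adj? _) (Adj-antitone p⊆q id)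

nbrCount-strictly-antitone : ∀ {F D} → p ⊆ q → F ∈ₗ D → Adj p F → ¬ Adj q F →
                             nbrCount q D < nbrCount p D
nbrCount-strictly-antitone p⊆q = length-filter-mono-< (adj? _) (adj? _) (Adj-antitone p⊆q id)

nbrCount-⊥ : ∀ (D : List (Subset n)) → nbrCount ⊥ D ≡ length D
nbrCount-⊥ D = cong length (filter-all (adj? ⊥) {xs = D} (All.tabulate λ {F} _ → ∩-zeroˡ F))

clique-length*≤ : ∀ {c} {U : Subset n} {L} → IsClique L → All (λ F → c ≤ ∣ F ∣) L → All (_⊆ U) L →
                  length L * c ≤ ∣ U ∣
clique-length*≤ [] [] [] = z≤n
clique-length*≤ {c = c} {U} {A ∷ L} (A-disjoint ∷ L-clique) (c≤∣A∣ ∷ c≤∣L∣) (A⊆U ∷ L⊆U) = begin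
  c + length L * c   ≤⟨ +-mono-≤ c≤∣A∣ (clique-length*≤ L-clique c≤∣L∣ L⊆U─A) ⟩
  ∣ A ∣ + ∣ U ─ A ∣  ≡⟨ +-comm ∣ A ∣ _ ⟩
  ∣ U ─ A ∣ + ∣ A ∣  ≡⟨ sym (∣p∣≡∣p─q∣+∣q∣ A⊆U) ⟩
  ∣ U ∣              ∎
  where
  open ≤-Reasoning
  L⊆U─A : All (_⊆ U ─ A) L
  L⊆U─A = All.zipWith (λ (A∩F≡⊥ , F⊆U) {x} x∈F → x∈p∧x∉q⇒x∈p─q (F⊆U x∈F) λ x∈A → Adj⇒∉ A∩F≡⊥ x∈A x∈F)
                      (A-disjoint , L⊆U)

clique-length*r≤n : ∀ {r} {D : List (Subset n)} → All (IsVertex n r) D → IsClique D → length D * r ≤ n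
clique-length*r≤n {n = n} {r} {D} vertices clique =
  subst (length D * r ≤_) (∣⊤∣≡n n)
    (clique-length*≤ {U = ⊤} clique (All.map (≤-reflexive ∘ sym) vertices) (All.tabulate λ _ _ → ∈⊤))

clique⇒Unique : ∀ {L : List (Subset n)} → IsClique L → All Nonempty L → Unique L
clique⇒Unique [] [] = []
clique⇒Unique (A-disjoint ∷ L-clique) (A-nonempty ∷ L-nonempty) =
  All.map (λ { A∩A≡⊥ refl → Nonempty⇒¬Adj-self A-nonempty A∩A≡⊥ }) A-disjoint
  ∷ clique⇒Unique L-clique L-nonempty

clique-length-meeting≤ : ∀ {D : List (Subset n)} → IsClique D → (u : Subset n) →
                         length (meeting u D) ≤ ∣ u ∣
clique-length-meeting≤ {D = D} clique u = begin
  length (meeting u D)          ≡⟨ sym (length-map (_∩ u) (meeting u D)) ⟩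
  length traces                 ≡⟨ sym (*-identityʳ _) ⟩
  length traces * 1             ≤⟨ clique-length*≤ traces-clique traces-nonempty traces⊆u ⟩
  ∣ u ∣                         ∎
  where
  open ≤-Reasoning
  traces = map (_∩ u) (meeting u D)
  traces-clique : IsClique traces
  traces-clique = AllPairs.map⁺ (AllPairs.map (Adj-antitone (p∩q⊆p _ u) (p∩q⊆p _ u))
                                              (AllPairs.filter⁺ (∁? (adj? u)) clique))
  traces-nonempty : All (λ F → 1 ≤ ∣ F ∣) traces
  traces-nonempty = All-map⁺ (All.tabulate λ F∈ →
    let x , x∈u , x∈F = ¬Adj⇒∃∈ (proj₂ (∈-filter⁻ (∁? (adj? u)) {xs = D} F∈))
    in Nonempty⇒∣p∣≥1 (x , x∈p∩q⁺ (x∈F , x∈u)))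
  traces⊆u : All (_⊆ u) traces
  traces⊆u = All-map⁺ (All.tabulate λ {F} _ → p∩q⊆q F u)

clique-IsKDom : ∀ {k r} {D : List (Subset n)} → 0 < r → All (IsVertex n r) D → IsClique D →
                length D ≡ k + r → IsKDom k n r D
clique-IsKDom {n = n} {k} {r} {D} 0<r vertices clique ∣D∣≡k+r =
  (vertices , clique⇒Unique clique (All.map (λ ∣F∣≡r → ∣p∣>0⇒Nonempty (subst (0 <_) (sym ∣F∣≡r) 0<r))
                                            vertices)) ,
  λ u ∣u∣≡r _ → k≤nbrCount u ∣u∣≡r
  where
  k≤nbrCount : ∀ u → IsVertex n r u → k ≤ nbrCount u D
  k≤nbrCount u ∣u∣≡r = +-cancelʳ-≤ r k (nbrCount u D) (begin
    k + r                                ≡⟨ sym ∣D∣≡k+r ⟩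
    length D                             ≡⟨ sym (nbrCount+meeting≡length u D) ⟩
    nbrCount u D + length (meeting u D)  ≤⟨ +-monoʳ-≤ (nbrCount u D) meeting≤r ⟩
    nbrCount u D + r                     ∎)
    where
    open ≤-Reasoning
    meeting≤r : length (meeting u D) ≤ r
    meeting≤r = subst (_ ≤_) ∣u∣≡r (clique-length-meeting≤ clique u)

KneserClique : (n r m : ℕ) → Set
KneserClique n r m = Σ[ D ∈ List (Subset n) ] length D ≡ m × All (IsVertex n r) D × IsClique D

block-clique : ∀ r m N → KneserClique (m * r + N) r m
block-clique r zero    N = [] , refl , [] , []
block-clique r (suc m) N =
  subst (λ N′ → KneserClique N′ r (suc m)) (sym (+-assoc r (m * r) N)) (add-block (block-clique r m N))
  where
  add-block : ∀ {N} → KneserClique N r m → KneserClique (r + N) r (suc m)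
  add-block {N} (D , ∣D∣≡m , vertices , clique) =
    (⊤ {r} ++ ⊥ {N}) ∷ map (⊥ {r} ++_) D ,
    cong suc (trans (length-map _ D) ∣D∣≡m) ,
    trans (∣p++q∣≡∣p∣+∣q∣ (⊤ {r}) (⊥ {N})) (trans (cong₂ _+_ (∣⊤∣≡n r) (∣⊥∣≡0 N)) (+-identityʳ r))
      ∷ All-map⁺ (All.map (λ {F} ∣F∣≡r → trans (∣p++q∣≡∣p∣+∣q∣ (⊥ {r}) F)
                                                  (trans (cong (_+ ∣ F ∣) (∣⊥∣≡0 r)) ∣F∣≡r)) vertices) ,
    All-map⁺ (All.tabulate λ {F} _ → Adj-++ (∩-zeroʳ (⊤ {r})) (∩-zeroˡ F))
      ∷ AllPairs.map⁺ (AllPairs.map (Adj-++ (∩-zeroˡ (⊥ {r}))) clique)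

kneser-clique : ∀ r m n → m * r ≤ n → KneserClique n r m
kneser-clique r m n m*r≤n =
  subst (λ N → KneserClique N r m) (m+[n∸m]≡n m*r≤n) (block-clique r m (n ∸ m * r))

module _ {k n s : ℕ} (2≤k : 2 ≤ k) (0<s : 0 < s) (n-large : k + 2 * suc s ≤ n)
         {D : List (Subset n)} (D-dominating : IsKDom k n (suc s) D) (D-small : length D ≤ k + suc s)
         where

  private
    D-vertices : All (IsVertex n (suc s)) D
    D-vertices = proj₁ (proj₁ D-dominating)

    D-unique : Unique D
    D-unique = proj₂ (proj₁ D-dominating)

    dominates : ∀ u → IsVertex n (suc s) u → u ∉ₗ D → k ≤ nbrCount u D
    dominates = proj₂ D-dominating

    1+∣D∣+s≤n : suc (length D) + s ≤ n
    1+∣D∣+s≤n = begin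
      suc (length D) + s       ≤⟨ +-monoˡ-≤ s (s≤s D-small) ⟩
      suc (k + suc s) + s      ≡⟨ rearrange k s ⟩
      k + 2 * suc s            ≤⟨ n-large ⟩
      n                        ∎
      where
      open ≤-Reasoning
      rearrange : ∀ k s → suc (k + suc s) + s ≡ k + 2 * suc s
      rearrange = solve-∀

    s<n : s < n
    s<n = ≤-trans (s≤s (m≤n+m s (length D))) 1+∣D∣+s≤n

  add-point : ∀ t (S : Subset n) → ∣ S ∣ < n → nbrCount S D ≤ k + suc t →
              ∃ λ y → y ∉ S × nbrCount (S ∪ ⁅ y ⁆) D ≤ k + t
  add-point t S ∣S∣<n bound with nbrCount S D ≤? k + t
  ... | yes ≤k+t = let y , y∉S = ∣p∣<n⇒∃∉ ∣S∣<n in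
    y , y∉S , ≤-trans (nbrCount-antitone (p⊆p∪q {p = S} ⁅ y ⁆) D) ≤k+t
  ... | no ≰k+t =
    let F , F∈ = 0<length⇒∃∈ (≤-trans (s≤s z≤n) (≰⇒> ≰k+t))
        F∈D , S∩F≡⊥ = ∈-filter⁻ (adj? S) {xs = D} F∈
        y , y∈F = ∣p∣>0⇒Nonempty (subst (0 <_) (sym (All.lookup D-vertices F∈D)) z<s)
        S∪y-meets-F = λ S∪y∩F≡⊥ → Adj⇒∉ S∪y∩F≡⊥ (q⊆p∪q S ⁅ y ⁆ (x∈⁅x⁆ y)) y∈F
        decrease = nbrCount-strictly-antitone (p⊆p∪q {p = S} ⁅ y ⁆) F∈D S∩F≡⊥ S∪y-meets-F
    in y , (λ y∈S → Adj⇒∉ S∩F≡⊥ y∈S y∈F) ,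
       ≤-pred (≤-trans decrease (≤-trans bound (≤-reflexive (+-suc k t))))

  grow : ∀ t (S : Subset n) → ∣ S ∣ + t ≡ s → nbrCount S D ≤ k + t →
         ∃ λ S′ → ∣ S′ ∣ ≡ s × nbrCount S′ D ≤ k
  grow zero    S ∣S∣+0≡s bound =
    S , trans (sym (+-identityʳ _)) ∣S∣+0≡s , subst (nbrCount S D ≤_) (+-identityʳ k) bound
  grow (suc t) S ∣S∣+1+t≡s bound =
    let y , y∉S , bound′ = add-point t S ∣S∣<n bound in
    grow t (S ∪ ⁅ y ⁆)
         (trans (cong (_+ t) (∣p∪⁅x⁆∣≡1+∣p∣ S y y∉S)) (trans (sym (+-suc _ t)) ∣S∣+1+t≡s)) bound′
    where
    ∣S∣<n : ∣ S ∣ < n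
    ∣S∣<n = <-trans (subst (∣ S ∣ <_) ∣S∣+1+t≡s (m<m+n ∣ S ∣ z<s)) s<n

  ¬nbrCount<k : ∀ (S : Subset n) → ∣ S ∣ ≡ s → ¬ (nbrCount S D < k)
  ¬nbrCount<k S ∣S∣≡s <k = <⇒≱ (≤-<-trans (nbrCount-antitone (p⊆p∪q {p = S} ⁅ z ⁆) D) <k)
    (dominates (S ∪ ⁅ z ⁆) (trans (∣p∪⁅x⁆∣≡1+∣p∣ S z (x∈∁p⇒x∉p z∈∁S)) (cong suc ∣S∣≡s)) S∪z∉D)
    where
    ∣D∣<∣∁S∣ : length D < ∣ ∁ S ∣
    ∣D∣<∣∁S∣ = subst (length D <_) (sym (trans (∣∁p∣≡n∸∣p∣ S) (cong (n ∸_) ∣S∣≡s)))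
                     (m+n≤o⇒m≤o∸n (suc (length D)) 1+∣D∣+s≤n)
    extension = ∃-extension-∉ S (∁ S) (∩-inverseʳ S) D ∣D∣<∣∁S∣
    z = proj₁ extension
    z∈∁S = proj₁ (proj₂ extension)
    S∪z∉D = proj₂ (proj₂ extension)

  ¬nbrCount≡k : ∀ (S : Subset n) → ∣ S ∣ ≡ s → ¬ (nbrCount S D ≡ k)
  ¬nbrCount≡k S ∣S∣≡s ≡k with 2≤length⇒∃≢ (Unique.filter⁺ (adj? S) D-unique) (subst (2 ≤_) (sym ≡k) 2≤k)
  ... | E₁ , E₂ , E₁∈ , E₂∈ , E₁≢E₂
    with ∈-filter⁻ (adj? S) {xs = D} E₁∈ | ∈-filter⁻ (adj? S) {xs = D} E₂∈
  ... | E₁∈D , S∩E₁≡⊥ | E₂∈D , S∩E₂≡⊥ = <⇒≱ S∪z-loses-a-neighbour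
          (dominates (S ∪ ⁅ z ⁆) (trans (∣p∪⁅x⁆∣≡1+∣p∣ S z z∉S) (cong suc ∣S∣≡s)) S∪z∉D)
    where
    S∩E₁∪E₂≡⊥ : Adj S (E₁ ∪ E₂)
    S∩E₁∪E₂≡⊥ = ∉⇒Adj λ x∈S x∈E₁∪E₂ → [ Adj⇒∉ S∩E₁≡⊥ x∈S , Adj⇒∉ S∩E₂≡⊥ x∈S ]′ (x∈p∪q⁻ E₁ E₂ x∈E₁∪E₂)
    ∣meeting∣<∣E₁∪E₂∣ : length (meeting S D) < ∣ E₁ ∪ E₂ ∣
    ∣meeting∣<∣E₁∪E₂∣ = begin-strict
      length (meeting S D)  ≤⟨ +-cancelˡ-≤ k _ _ (begin
          k + length (meeting S D)             ≡⟨ cong (_+ _) (sym ≡k) ⟩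
          nbrCount S D + length (meeting S D)  ≡⟨ nbrCount+meeting≡length S D ⟩
          length D                             ≤⟨ D-small ⟩
          k + suc s                            ∎) ⟩
      suc s                 ≡⟨ sym (All.lookup D-vertices E₁∈D) ⟩
      ∣ E₁ ∣                <⟨ ∣p∣<∣p∪q∣ E₁≢E₂ ∣E₁∣≡∣E₂∣ ⟩
      ∣ E₁ ∪ E₂ ∣           ∎
      where
      open ≤-Reasoning
      ∣E₁∣≡∣E₂∣ = trans (All.lookup D-vertices E₁∈D) (sym (All.lookup D-vertices E₂∈D))
    extension = ∃-extension-∉ S (E₁ ∪ E₂) S∩E₁∪E₂≡⊥ (meeting S D) ∣meeting∣<∣E₁∪E₂∣
    z = proj₁ extension
    z∈E₁∪E₂ = proj₁ (proj₂ extension)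
    z∉S : z ∉ S
    z∉S z∈S = Adj⇒∉ S∩E₁∪E₂≡⊥ z∈S z∈E₁∪E₂
    S∪z∉D : S ∪ ⁅ z ⁆ ∉ₗ D
    S∪z∉D S∪z∈D = proj₂ (proj₂ extension)
      (⊆-∈-meeting (p⊆p∪q ⁅ z ⁆) (∣p∣>0⇒Nonempty (subst (0 <_) (sym ∣S∣≡s) 0<s)) S∪z∈D)
    S∪z-meets : ∀ {E} → z ∈ E → ¬ Adj (S ∪ ⁅ z ⁆) E
    S∪z-meets z∈E S∪z∩E≡⊥ = Adj⇒∉ S∪z∩E≡⊥ (q⊆p∪q S ⁅ z ⁆ (x∈⁅x⁆ z)) z∈E
    S∪z-loses-a-neighbour : nbrCount (S ∪ ⁅ z ⁆) D < k
    S∪z-loses-a-neighbour = subst (nbrCount (S ∪ ⁅ z ⁆) D <_) ≡k (case-z (x∈p∪q⁻ E₁ E₂ z∈E₁∪E₂))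
      where
      case-z : z ∈ E₁ ⊎ z ∈ E₂ → nbrCount (S ∪ ⁅ z ⁆) D < nbrCount S D
      case-z (inj₁ z∈E₁) = nbrCount-strictly-antitone (p⊆p∪q ⁅ z ⁆) E₁∈D S∩E₁≡⊥ (S∪z-meets z∈E₁)
      case-z (inj₂ z∈E₂) = nbrCount-strictly-antitone (p⊆p∪q ⁅ z ⁆) E₂∈D S∩E₂≡⊥ (S∪z-meets z∈E₂)

  no-small-set : ∀ (S : Subset n) t → ∣ S ∣ + t ≡ s → ¬ (nbrCount S D ≤ k + t)
  no-small-set S t ∣S∣+t≡s bound with grow t S ∣S∣+t≡s bound
  ... | S′ , ∣S′∣≡s , ≤k with m≤n⇒m<n∨m≡n ≤k
  ... | inj₁ <k = ¬nbrCount<k S′ ∣S′∣≡s <k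
  ... | inj₂ ≡k = ¬nbrCount≡k S′ ∣S′∣≡s ≡k

IsKDom⇒k+r≤length : ∀ {k n s} → 2 ≤ k → 0 < s → k + 2 * suc s ≤ n →
        ∀ {D} → IsKDom k n (suc s) D → k + suc s ≤ length D
IsKDom⇒k+r≤length {k} {n} {s} 2≤k 0<s n-large {D} D-dominating = ≮⇒≥ λ ∣D∣<k+r →
  no-small-set 2≤k 0<s n-large D-dominating (<⇒≤ ∣D∣<k+r) ⊥ s (cong (_+ s) (∣⊥∣≡0 n))
    (subst (_≤ k + s) (sym (nbrCount-⊥ D)) (≤-pred (≤-trans ∣D∣<k+r (≤-reflexive (+-suc k s)))))

nbrCount⁅x⁆+2≤length : ∀ {D : List (Subset n)} {A B} → A ∈ₗ D → B ∈ₗ D → A ≢ B →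
                        x ∈ A → x ∈ B → nbrCount ⁅ x ⁆ D + 2 ≤ length D
nbrCount⁅x⁆+2≤length {x = x} {D} {A} {B} A∈D B∈D A≢B x∈A x∈B = begin
  nbrCount ⁅ x ⁆ D + 2                         ≤⟨ +-monoʳ-≤ (nbrCount ⁅ x ⁆ D) two-meet ⟩
  nbrCount ⁅ x ⁆ D + length (meeting ⁅ x ⁆ D)  ≡⟨ nbrCount+meeting≡length ⁅ x ⁆ D ⟩
  length D                                     ∎
  where
  open ≤-Reasoning
  ∈-meeting : ∀ {F} → F ∈ₗ D → x ∈ F → F ∈ₗ meeting ⁅ x ⁆ D
  ∈-meeting F∈D x∈F = ⊆-∈-meeting (x∈p⇒⁅x⁆⊆p x∈F) (x , x∈⁅x⁆ x) F∈D
  two-meet : 2 ≤ length (meeting ⁅ x ⁆ D)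
  two-meet = Unique⇒length≤ _≟ˢ_ ((A≢B ∷ []) ∷ [] ∷ [])
    λ { (here refl) → ∈-meeting A∈D x∈A ; (there (here refl)) → ∈-meeting B∈D x∈B }

IsKDom∧length≡k+r⇒IsClique : ∀ {k n s} → 2 ≤ k → 0 < s → k + 2 * suc s ≤ n →
  ∀ {D} → IsKDom k n (suc s) D → length D ≡ k + suc s → IsClique D
IsKDom∧length≡k+r⇒IsClique {k} {n} {suc s} 2≤k 0<s n-large {D} D-dominating ∣D∣≡k+r =
  Unique⇒AllPairs (proj₂ (proj₁ D-dominating)) disjoint
  where
  disjoint : ∀ {A B} → A ∈ₗ D → B ∈ₗ D → A ≢ B → Adj A B
  disjoint {A} {B} A∈D B∈D A≢B with adj? A B
  ... | yes A∩B≡⊥ = A∩B≡⊥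
  ... | no ¬adj with ¬Adj⇒∃∈ ¬adj
  ...   | x , x∈A , x∈B =
    contradiction nbrCount⁅x⁆≤k+s
      (no-small-set 2≤k 0<s n-large D-dominating (≤-reflexive ∣D∣≡k+r) ⁅ x ⁆ s (cong (_+ s) (∣⁅x⁆∣≡1 x)))
    where
    nbrCount⁅x⁆≤k+s : nbrCount ⁅ x ⁆ D ≤ k + s
    nbrCount⁅x⁆≤k+s = +-cancelʳ-≤ 2 _ _ (begin
      nbrCount ⁅ x ⁆ D + 2  ≤⟨ nbrCount⁅x⁆+2≤length A∈D B∈D A≢B x∈A x∈B ⟩
      length D              ≡⟨ ∣D∣≡k+r ⟩
      k + (2 + s)           ≡⟨ cong (k +_) (+-comm 2 s) ⟩
      k + (s + 2)           ≡⟨ sym (+-assoc k s 2) ⟩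
      k + s + 2             ∎)
      where open ≤-Reasoning

IsKDom∧length≡k+r⇒r*[k+r]≤n : ∀ {k n s} → 2 ≤ k → 0 < s → k + 2 * suc s ≤ n →
  ∀ {D} → IsKDom k n (suc s) D → length D ≡ k + suc s → suc s * (k + suc s) ≤ n
IsKDom∧length≡k+r⇒r*[k+r]≤n {k} {n} {s} 2≤k 0<s n-large D-dominating ∣D∣≡k+r =
  subst (_≤ n) (trans (cong (_* suc s) ∣D∣≡k+r) (*-comm (k + suc s) (suc s)))
    (clique-length*r≤n (proj₁ (proj₁ D-dominating))
                       (IsKDom∧length≡k+r⇒IsClique 2≤k 0<s n-large D-dominating ∣D∣≡k+r))

∃-IsKDom-length≡k+r : ∀ {k n r} → 0 < r → r * (k + r) ≤ n →
                      Σ[ D ∈ List (Subset n) ] IsKDom k n r D × length D ≡ k + r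
∃-IsKDom-length≡k+r {k} {n} {r} 0<r r*[k+r]≤n =
  let D , ∣D∣≡k+r , vertices , clique =
        kneser-clique r (k + r) n (subst (_≤ n) (*-comm r (k + r)) r*[k+r]≤n)
  in D , clique-IsKDom 0<r vertices clique ∣D∣≡k+r , ∣D∣≡k+r

mainTheorem5 : (k n r : ℕ) → 2 ≤ k → 2 ≤ r → k + 2 * r ≤ n →
    ((GammaIs k n r (k + r) ⇔ r * (k + r) ≤ n)
      × (r * (k + r) ≤ n → (D : List (Subset n)) → IsKDom k n r D →
           GammaIs k n r (length D) → IsClique D))
    × (GammaAtLeast k n r (k + r + 1) ⇔ n < r * (k + r))
mainTheorem5 k n r@(suc (suc s)) 2≤k (s≤s (s≤s z≤n)) n-large =
  (mk⇔ minimum⇒large large⇒minimum , large⇒minimum-IsClique) , mk⇔ above⇒small small⇒above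
  where
  lower : ∀ {D} → IsKDom k n r D → k + r ≤ length D
  lower = IsKDom⇒k+r≤length 2≤k z<s n-large

  size-k+r⇒large : ∀ {D} → IsKDom k n r D → length D ≡ k + r → r * (k + r) ≤ n
  size-k+r⇒large = IsKDom∧length≡k+r⇒r*[k+r]≤n 2≤k z<s n-large

  minimum⇒large : GammaIs k n r (k + r) → r * (k + r) ≤ n
  minimum⇒large ((_ , D-dominating , ∣D∣≡k+r) , _) = size-k+r⇒large D-dominating ∣D∣≡k+r

  large⇒minimum : r * (k + r) ≤ n → GammaIs k n r (k + r)
  large⇒minimum large = ∃-IsKDom-length≡k+r z<s large , λ _ → lower

  large⇒minimum-IsClique : r * (k + r) ≤ n → (D : List (Subset n)) → IsKDom k n r D →
                           GammaIs k n r (length D) → IsClique D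
  large⇒minimum-IsClique large D D-dominating (_ , D-minimum) =
    let D₀ , D₀-dominating , ∣D₀∣≡k+r = ∃-IsKDom-length≡k+r z<s large in
    IsKDom∧length≡k+r⇒IsClique 2≤k z<s n-large D-dominating
      (≤-antisym (≤-trans (D-minimum D₀ D₀-dominating) (≤-reflexive ∣D₀∣≡k+r)) (lower D-dominating))

  above⇒small : GammaAtLeast k n r (k + r + 1) → n < r * (k + r)
  above⇒small above = ≰⇒> λ large →
    let D₀ , D₀-dominating , ∣D₀∣≡k+r = ∃-IsKDom-length≡k+r z<s large in
    1+n≰n (subst (_≤ k + r) (+-comm (k + r) 1) (≤-trans (above D₀ D₀-dominating) (≤-reflexive ∣D₀∣≡k+r)))

  small⇒above : n < r * (k + r) → GammaAtLeast k n r (k + r + 1)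
  small⇒above small D D-dominating = subst (_≤ length D) (+-comm 1 (k + r))
    (≤∧≢⇒< (lower D-dominating) λ k+r≡∣D∣ → <⇒≱ small (size-k+r⇒large D-dominating (sym k+r≡∣D∣)))
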